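{- Let $C$ be a set. The maps $G\mapsto\prec_G$ (from Plott functions on $C$ to Lehmann hyper-orders on $C$) and $\prec\mapsto T_\prec$ (from Lehmann hyper-orders on $C$ to Plott functions on $C$) are mutually inverse bijections between the set of Plott functions on $C$ and the set of Lehmann hyper-orders on $C$.
   Context: A choice function on $C$ is a map $G:2^C\to2^C$ with $G(X)\subseteq X$; it is a Plott function if $G(X\cup Y)=G(G(X)\cup Y)$ for all $X,Y\subseteq C$. For a Plott function $G$, $A\prec_G B$ iff $G(B)\neq\emptyset$ and $G(A\cup B)\cap A=\emptyset$. A hyper-relation on $C$ is a binary relation $\prec$ on subsets of $C$; $B$ is essential if $\emptyset\prec B$ and insignificant otherwise. A Lehmann hyper-order is a hyper-relation satisfying: (L0) irreflexivity; (L1) if $A'\subseteq A\prec B$ then $A'\prec B$; (L2) if $(A_i)_{i\in I}$ is a nonempty family with $A_i\prec B$ for all $i$, then $\bigcup_iA_i\prec B$; (L3) if $A\prec B\subseteq B'$ then $A\prec B'$; (L4) if $A\prec A\cup B$ then $A\prec B$; (L5) if $A$ is essential and $B$ is insignificant then $B\prec A$. For a Lehmann hyper-order $\prec$, let $D$ be the set of $c\in C$ with $\{c\}$ insignificant, $L(A)=D\cup\{c\in C:\{c\}\prec A\}$, and $T_\prec(A)=A\setminus L(A)$. -}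

module Defs where

open import Level using (0ℓ)
open import Data.Product using (_×_; _,_)
open import Data.Sum using (_⊎_)
open import Relation.Nullary using (¬_)
open import Relation.Unary using (Pred; _⊆_; _≐_; _∪_; _∩_; ∅; ｛_｝; ⋃; Empty; Satisfiable)

-- Subsets of C are predicates C → Set; equality of subsets is extensional (_≐_).
Subset : Set → Set₁
Subset C = Pred C 0ℓ

SetOp : Set → Set₁
SetOp C = Subset C → Subset C

HyperRel : Set → Set₁
HyperRel C = Subset C → Subset C → Set

module _ {C : Set} where

  record IsChoiceFunction (G : SetOp C) : Set₁ where
    field
      resp : ∀ {X Y} → X ≐ Y → G X ≐ G Y
      sub  : ∀ X → G X ⊆ X

  record IsPlott (G : SetOp C) : Set₁ where
    field
      isChoice : IsChoiceFunction G
      plott    : ∀ X Y → G (X ∪ Y) ≐ G (G X ∪ Y)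

  precG : SetOp C → HyperRel C
  precG G A B = Satisfiable (G B) × Empty (G (A ∪ B) ∩ A)

  Essential : HyperRel C → Subset C → Set
  Essential _≺_ B = ∅ ≺ B

  Insignificant : HyperRel C → Subset C → Set
  Insignificant _≺_ B = ¬ (∅ ≺ B)

  record IsLehmann (_≺_ : HyperRel C) : Set₁ where
    field
      resp : ∀ {A A' B B'} → A ≐ A' → B ≐ B' → A ≺ B → A' ≺ B'
      L0 : ∀ A → ¬ (A ≺ A)
      L1 : ∀ {A' A B} → A' ⊆ A → A ≺ B → A' ≺ B
      L2 : ∀ {B} (I : Set) → I → (As : I → Subset C) →
           (∀ i → As i ≺ B) → ⋃ I As ≺ B
      L3 : ∀ {A B B'} → A ≺ B → B ⊆ B' → A ≺ B'
      L4 : ∀ {A B} → A ≺ (A ∪ B) → A ≺ B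
      L5 : ∀ {A B} → Essential _≺_ A → Insignificant _≺_ B → B ≺ A

  Lset : HyperRel C → Subset C → Subset C
  Lset _≺_ A c = Insignificant _≺_ ｛ c ｝ ⊎ (｛ c ｝ ≺ A)

  T : HyperRel C → SetOp C
  T _≺_ A c = A c × ¬ Lset _≺_ A c

{-# OPTIONS --safe #-}
-- For a Plott function G, path independence yields outcast (G Y ⊆ X ⊆ Y gives
-- G X = G Y) and heritage (X ⊆ Y gives G Y ∩ X ⊆ G X); the Lehmann axioms for
-- ≺_G follow from these, which also show that c ∈ G X exactly when {c} is
-- essential and not below X, i.e. T_{≺_G} = G.
-- For a Lehmann hyper-order, the key fact is that A ≺ B iff A ⊆ L(B) when B is
-- essential: points of D are handled by L5 (D itself being insignificant) and the
-- singletons {c} ≺ B are glued by L2. This recovers ≺ from T_≺, and T_≺ is path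
-- independent because discarding points of L(X) from X does not change L.
module Submission where

open import Defs
open import Level using (0ℓ)
open import Axiom.ExcludedMiddle using (ExcludedMiddle)
open import Axiom.DoubleNegationElimination using (em⇒dne)
open import Data.Bool using (Bool; true; false)
open import Data.Empty using (⊥-elim)
open import Data.Product using (_×_; _,_; proj₁; proj₂; Σ)
import Data.Product as Product
open import Data.Sum using (_⊎_; inj₁; inj₂; [_,_]; [_,_]′)
import Data.Sum as Sum
open import Data.Unit using (⊤; tt)
open import Function.Base using (id; _∘_)
open import Function.Bundles using (_⇔_; mk⇔; Equivalence)
open import Relation.Nullary using (¬_; yes; no)
open import Relation.Unary using (_≐_; _⊆_; _∪_; _∩_; _∖_; ∅; ｛_｝; ⋃; Empty; Satisfiable)
open import Relation.Unary.Algebra using (∪-cong; ∪-idem)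
open import Relation.Unary.Relation.Binary.Equality using (≐-setoid)
open import Relation.Binary.PropositionalEquality using (refl)

module _ {C : Set} where

  singleton-⊆ : {X : Subset C} {c : C} → X c → ｛ c ｝ ⊆ X
  singleton-⊆ Xc refl = Xc

  ∪-absorbˡ : {X Y : Subset C} → X ⊆ Y → X ∪ Y ≐ Y
  ∪-absorbˡ X⊆Y = [ X⊆Y , id ] , inj₂

  ∪-absorbʳ : {X Y : Subset C} → X ⊆ Y → Y ∪ X ≐ Y
  ∪-absorbʳ X⊆Y = [ id , X⊆Y ] , inj₁

  ⊆-∪-∖ : ExcludedMiddle 0ℓ → {Y : Subset C} (P : Subset C) → Y ⊆ P ∪ (Y ∖ P)
  ⊆-∪-∖ em P {d} Yd with em {P d}
  ... | yes Pd = inj₁ Pd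
  ... | no ¬Pd = inj₂ (Yd , ¬Pd)

module PlottFunction {C : Set} {G : SetOp C} (plottG : IsPlott G) where
  open IsPlott plottG
  open IsChoiceFunction isChoice
  open import Relation.Binary.Reasoning.Setoid (≐-setoid C 0ℓ)

  outcast : {X Y : Subset C} → G Y ⊆ X → X ⊆ Y → G X ≐ G Y
  outcast {X} {Y} GY⊆X X⊆Y = begin
    G X          ≈⟨ resp (∪-absorbˡ GY⊆X) ⟨
    G (G Y ∪ X)  ≈⟨ plott Y X ⟨
    G (Y ∪ X)    ≈⟨ resp (∪-absorbʳ X⊆Y) ⟩
    G Y          ∎

  choice-⊆ʳ : {A B : Subset C} → Empty (G (A ∪ B) ∩ A) → G (A ∪ B) ⊆ B
  choice-⊆ʳ {A} {B} avoidA {d} g with sub (A ∪ B) g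
  ... | inj₁ Ad = ⊥-elim (avoidA d (g , Ad))
  ... | inj₂ Bd = Bd

  choice-singleton : {c : C} → Satisfiable (G ｛ c ｝) → G ｛ c ｝ c
  choice-singleton (d , g) with sub _ g
  ... | refl = g

  precG-essential : {B : Subset C} → Satisfiable (G B) → Essential (precG G) B
  precG-essential GB≠∅ = GB≠∅ , λ _ ()

  precG-resp : ∀ {A A' B B'} → A ≐ A' → B ≐ B' → precG G A B → precG G A' B'
  precG-resp A≐A' B≐B' ((d , g) , avoidA) =
    (d , proj₁ (resp B≐B') g) ,
    λ e (g' , A'e) → avoidA e (proj₂ (resp (∪-cong A≐A' B≐B')) g' , proj₂ A≐A' A'e)

  precG-irrefl : ∀ A → ¬ precG G A A
  precG-irrefl A ((d , g) , avoidA) = avoidA d (proj₂ (resp (∪-idem A)) g , sub A g)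

  precG-antitoneˡ : ∀ {A' A B} → A' ⊆ A → precG G A B → precG G A' B
  precG-antitoneˡ {A'} {A} {B} A'⊆A (GB≠∅ , avoidA) = GB≠∅ , avoidA'
    where
      same-choice : G (A' ∪ B) ≐ G (A ∪ B)
      same-choice = outcast (λ g → inj₂ (choice-⊆ʳ avoidA g)) (Sum.map A'⊆A id)
      avoidA' : Empty (G (A' ∪ B) ∩ A')
      avoidA' d (g , A'd) = avoidA d (proj₁ same-choice g , A'⊆A A'd)

  precG-∪-elimˡ : ∀ {A B} → precG G A (A ∪ B) → precG G A B
  precG-∪-elimˡ {A} {B} (GA∪B≠∅ , avoidA) = GB≠∅ , avoidA'
    where
      avoidA' : Empty (G (A ∪ B) ∩ A)
      avoidA' d (g , Ad) = avoidA d (proj₂ (resp (∪-absorbˡ inj₁)) g , Ad)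
      GB≠∅ : Satisfiable (G B)
      GB≠∅ = let (d , g) = GA∪B≠∅ in d , proj₂ (outcast (choice-⊆ʳ avoidA') inj₂) g

  module _ (em : ExcludedMiddle 0ℓ) where

    heritage : {X Y : Subset C} → X ⊆ Y → G Y ∩ X ⊆ G X
    heritage {X} {Y} X⊆Y {c} (GYc , Xc) =
      fromChosen (sub _ (proj₁ (plott X Z) (proj₁ (resp Y≐X∪Z) GYc)))
      where
        Z : Subset C
        Z = Y ∖ ｛ c ｝
        Y≐X∪Z : Y ≐ X ∪ Z
        Y≐X∪Z = (λ Yd → Sum.map (singleton-⊆ Xc) id (⊆-∪-∖ em {Y} ｛ c ｝ Yd)) , [ X⊆Y , proj₁ ]
        fromChosen : (G X ∪ Z) c → G X c
        fromChosen (inj₁ GXc) = GXc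
        fromChosen (inj₂ (_ , c≢c)) = ⊥-elim (c≢c refl)

    choice-nonempty-mono : {X Y : Subset C} → X ⊆ Y → Satisfiable (G X) → Satisfiable (G Y)
    choice-nonempty-mono {X} {Y} X⊆Y (d , g) = em⇒dne em λ GY=∅ →
      GY=∅ (d , proj₁ (outcast (λ {e} GYe → ⊥-elim (GY=∅ (e , GYe))) X⊆Y) g)

    precG-⋃ˡ : ∀ {B} (I : Set) → I → (As : I → Subset C) →
               (∀ i → precG G (As i) B) → precG G (⋃ I As) B
    precG-⋃ˡ {B} I i As As≺B = proj₁ (As≺B i) , avoid⋃
      where
        avoid⋃ : Empty (G (⋃ I As ∪ B) ∩ ⋃ I As)
        avoid⋃ d (g , (j , Ajd)) =
          proj₂ (As≺B j) d (heritage (Sum.map (j ,_) id) (g , inj₁ Ajd) , Ajd)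

    precG-monoʳ : ∀ {A B B'} → precG G A B → B ⊆ B' → precG G A B'
    precG-monoʳ (GB≠∅ , avoidA) B⊆B' =
      choice-nonempty-mono B⊆B' GB≠∅ ,
      λ d (g , Ad) → avoidA d (heritage (Sum.map id B⊆B') (g , inj₁ Ad) , Ad)

    precG-insignificant≺essential : ∀ {A B} → Essential (precG G) A →
                                   Insignificant (precG G) B → precG G B A
    precG-insignificant≺essential (GA≠∅ , _) B-insig =
      GA≠∅ , λ d (g , Bd) → B-insig (precG-essential (d , heritage inj₁ (g , Bd)))

    precG-isLehmann : IsLehmann (precG G)
    precG-isLehmann = record
      { resp = precG-resp
      ; L0 = precG-irrefl
      ; L1 = precG-antitoneˡ
      ; L2 = precG-⋃ˡ
      ; L3 = precG-monoʳ
      ; L4 = precG-∪-elimˡ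
      ; L5 = precG-insignificant≺essential
      }

    T-precG : ∀ X → T (precG G) X ≐ G X
    T-precG X = T⊆G , G⊆T
      where
        T⊆G : T (precG G) X ⊆ G X
        T⊆G {c} (Xc , c∉L) = em⇒dne em λ c∉GX →
          c∉L (inj₂ (choice-nonempty-mono c⊆X (c , Gcc) , λ { _ (g , refl) →
            c∉GX (proj₁ (resp (∪-absorbˡ c⊆X)) g) }))
          where
            c⊆X : ｛ c ｝ ⊆ X
            c⊆X = singleton-⊆ Xc
            Gcc : G ｛ c ｝ c
            Gcc = choice-singleton (proj₁ (em⇒dne em λ c-insig → c∉L (inj₁ c-insig)))
        G⊆T : G X ⊆ T (precG G) X
        G⊆T {c} GXc = sub X GXc , [ c-essential , c⊀X ]
          where
            c⊆X : ｛ c ｝ ⊆ X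
            c⊆X = singleton-⊆ (sub X GXc)
            c-essential : ¬ Insignificant (precG G) ｛ c ｝
            c-essential c-insig = c-insig (precG-essential (c , heritage c⊆X (GXc , refl)))
            c⊀X : ¬ precG G ｛ c ｝ X
            c⊀X (_ , avoid-c) = avoid-c c (proj₂ (resp (∪-absorbˡ c⊆X)) GXc , refl)

module LehmannHyperOrder {C : Set} {_≺_ : HyperRel C} (lehmann : IsLehmann _≺_) where
  open IsLehmann lehmann

  L : Subset C → Subset C
  L = Lset _≺_

  D : Subset C
  D c = Insignificant _≺_ ｛ c ｝

  ≺-essentialʳ : ∀ {A B} → A ≺ B → Essential _≺_ B
  ≺-essentialʳ = L1 (λ ())

  insignificant-antitone : ∀ {A B} → A ⊆ B → Insignificant _≺_ B → Insignificant _≺_ A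
  insignificant-antitone A⊆B B-insig ∅≺A = B-insig (L3 ∅≺A A⊆B)

  ≺-∪ˡ : ∀ {A A' B} → A ≺ B → A' ≺ B → (A ∪ A') ≺ B
  ≺-∪ˡ {A} {A'} A≺B A'≺B = L1 cover (L2 Bool true pick pick≺B)
    where
      pick : Bool → Subset C
      pick true  = A
      pick false = A'
      pick≺B : ∀ b → pick b ≺ _
      pick≺B true  = A≺B
      pick≺B false = A'≺B
      cover : A ∪ A' ⊆ ⋃ Bool pick
      cover = [ (true ,_) , (false ,_) ]

  -- The index ⊤ keeps the family nonempty (and contributes ∅), as L2 demands.
  ≺-fromPoints : ∀ {A B} → Essential _≺_ B → (∀ {c} → A c → ｛ c ｝ ≺ B) → A ≺ B
  ≺-fromPoints {A} {B} ∅≺B points≺B = L1 cover (L2 (⊤ ⊎ Σ C A) (inj₁ tt) piece piece≺B)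
    where
      piece : ⊤ ⊎ Σ C A → Subset C
      piece (inj₁ _)       = ∅
      piece (inj₂ (c , _)) = ｛ c ｝
      piece≺B : ∀ i → piece i ≺ B
      piece≺B (inj₁ _)        = ∅≺B
      piece≺B (inj₂ (_ , Ac)) = points≺B Ac
      cover : A ⊆ ⋃ (⊤ ⊎ Σ C A) piece
      cover {c} Ac = inj₂ (c , Ac) , refl

  D-insignificant : Insignificant _≺_ D
  D-insignificant ∅≺D = L0 D (≺-fromPoints ∅≺D (L5 ∅≺D))

  ≺⇒⊆L : ∀ {A B} → A ≺ B → A ⊆ L B
  ≺⇒⊆L A≺B Ac = inj₂ (L1 (singleton-⊆ Ac) A≺B)

  ⊆L⇒≺ : ∀ {A B} → Essential _≺_ B → A ⊆ L B → A ≺ B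
  ⊆L⇒≺ {A} {B} ∅≺B A⊆LB = L1 split (≺-∪ˡ A∩D≺B (≺-fromPoints ∅≺B proj₂))
    where
      A∩D≺B : (A ∩ D) ≺ B
      A∩D≺B = L5 ∅≺B (insignificant-antitone proj₂ D-insignificant)
      split : A ⊆ (A ∩ D) ∪ (A ∩ λ c → ｛ c ｝ ≺ B)
      split Ac = Sum.map (Ac ,_) (Ac ,_) (A⊆LB Ac)

  L-mono : ∀ {X Y} → X ⊆ Y → L X ⊆ L Y
  L-mono X⊆Y = Sum.map id (λ c≺X → L3 c≺X X⊆Y)

  T-resp : ∀ {X Y} → X ≐ Y → T _≺_ X ≐ T _≺_ Y
  T-resp (X⊆Y , Y⊆X) =
    Product.map X⊆Y (λ c∉LX → c∉LX ∘ L-mono Y⊆X) ,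
    Product.map Y⊆X (λ c∉LY → c∉LY ∘ L-mono X⊆Y)

  module _ (em : ExcludedMiddle 0ℓ) where

    T-nonempty⇔essential : ∀ {A} → Satisfiable (T _≺_ A) ⇔ Essential _≺_ A
    T-nonempty⇔essential {A} = mk⇔
      (λ (c , Ac , c∉LA) → em⇒dne em λ A-insig →
        c∉LA (inj₁ (insignificant-antitone (singleton-⊆ Ac) A-insig)))
      (λ ∅≺A → em⇒dne em λ TA=∅ →
        L0 A (⊆L⇒≺ ∅≺A (λ {c} Ac → em⇒dne em λ c∉LA → TA=∅ (c , Ac , c∉LA))))

    T-disjoint⇔⊆L : {A Z : Subset C} → A ⊆ Z → Empty (T _≺_ Z ∩ A) ⇔ A ⊆ L Z
    T-disjoint⇔⊆L A⊆Z = mk⇔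
      (λ disjoint {c} Ac → em⇒dne em λ c∉LZ → disjoint c ((A⊆Z Ac , c∉LZ) , Ac))
      (λ A⊆LZ c ((_ , c∉LZ) , Ac) → c∉LZ (A⊆LZ Ac))

    precG-T⇔ : ∀ A B → precG (T _≺_) A B ⇔ A ≺ B
    precG-T⇔ A B = mk⇔
      (λ (TB≠∅ , disjoint) →
        let ∅≺B = Equivalence.to T-nonempty⇔essential TB≠∅
        in L4 (⊆L⇒≺ (L3 ∅≺B inj₂) (Equivalence.to (T-disjoint⇔⊆L inj₁) disjoint)))
      (λ A≺B →
        Equivalence.from T-nonempty⇔essential (≺-essentialʳ A≺B) ,
        Equivalence.from (T-disjoint⇔⊆L inj₁) (≺⇒⊆L (L3 A≺B inj₂)))

    -- With A = ｛ c ｝ ∪ (Z ∖ W): A ⊆ L Z gives A ≺ Z ⊆ A ∪ W, and L4 cancels A on the right.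
    L-shrink : {Z W : Subset C} → Z ∖ W ⊆ L Z → L Z ⊆ L W
    L-shrink Z∖W⊆LZ (inj₁ c-insig) = inj₁ c-insig
    L-shrink {Z} {W} Z∖W⊆LZ {c} (inj₂ c≺Z) = inj₂ (L1 inj₁ (L4 (L3 A≺Z Z⊆A∪W)))
      where
        A : Subset C
        A = ｛ c ｝ ∪ (Z ∖ W)
        A≺Z : A ≺ Z
        A≺Z = ⊆L⇒≺ (≺-essentialʳ c≺Z) [ singleton-⊆ {X = L Z} (inj₂ c≺Z) , Z∖W⊆LZ ]
        Z⊆A∪W : Z ⊆ A ∪ W
        Z⊆A∪W Zd = [ inj₂ , inj₁ ∘ inj₂ ]′ (⊆-∪-∖ em {Z} W Zd)

    L-∪-T : ∀ X Y → L (X ∪ Y) ⊆ L (T _≺_ X ∪ Y)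
    L-∪-T X Y = L-shrink removed⊆L
      where
        removed⊆L : (X ∪ Y) ∖ (T _≺_ X ∪ Y) ⊆ L (X ∪ Y)
        removed⊆L (inj₁ Xc , c∉TX∪Y) =
          L-mono inj₁ (em⇒dne em λ c∉LX → c∉TX∪Y (inj₁ (Xc , c∉LX)))
        removed⊆L (inj₂ Yc , c∉TX∪Y) = ⊥-elim (c∉TX∪Y (inj₂ Yc))

    T-plott : ∀ X Y → T _≺_ (X ∪ Y) ≐ T _≺_ (T _≺_ X ∪ Y)
    T-plott X Y = forward , backward
      where
        TX∪Y⊆X∪Y : T _≺_ X ∪ Y ⊆ X ∪ Y
        TX∪Y⊆X∪Y = Sum.map proj₁ id
        forward : T _≺_ (X ∪ Y) ⊆ T _≺_ (T _≺_ X ∪ Y)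
        forward (inj₁ Xc , c∉L) = inj₁ (Xc , c∉L ∘ L-mono inj₁) , c∉L ∘ L-mono TX∪Y⊆X∪Y
        forward (inj₂ Yc , c∉L) = inj₂ Yc , c∉L ∘ L-mono TX∪Y⊆X∪Y
        backward : T _≺_ (T _≺_ X ∪ Y) ⊆ T _≺_ (X ∪ Y)
        backward (c∈TX∪Y , c∉L) = TX∪Y⊆X∪Y c∈TX∪Y , c∉L ∘ L-∪-T X Y

    T-isPlott : IsPlott (T _≺_)
    T-isPlott = record
      { isChoice = record { resp = T-resp ; sub = λ _ → proj₁ }
      ; plott    = T-plott
      }

mainTheorem14 : (C : Set) → ExcludedMiddle 0ℓ →
    ((G : SetOp C) → IsPlott G → IsLehmann (precG G))
    × ((R : HyperRel C) → IsLehmann R → IsPlott (T R))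
    × ((G : SetOp C) → IsPlott G → ∀ X → T (precG G) X ≐ G X)
    × ((R : HyperRel C) → IsLehmann R → ∀ A B → precG (T R) A B ⇔ R A B)
mainTheorem14 C em =
  (λ G plottG → PlottFunction.precG-isLehmann plottG em) ,
  (λ R lehmannR → LehmannHyperOrder.T-isPlott lehmannR em) ,
  (λ G plottG → PlottFunction.T-precG plottG em) ,
  (λ R lehmannR → LehmannHyperOrder.precG-T⇔ lehmannR em)
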